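{- For every $l\in\mathbb{N}$ there are sequences $(\sigma_{l,i})_{i=1}^l$ and $(\tau_{l,i})_{i=1}^l$ of elements of $S_{3^l}$ such that, for $1\le i<j\le l$, $\sigma_{l,i}$ and $\tau_{l,j}$ commute, while for $1\le j\le i\le l$ the commutator $[\sigma_{l,i},\tau_{l,j}]$ is a product of $3^{l-1}$ disjoint cycles of length $3$.
   Context: $S_n$ denotes the symmetric group on $\{1,\dots,n\}$. For group elements $a,b$, $[a,b]=aba^{ -1}b^{ -1}$. -}

module Defs where

open import Data.Nat using (ℕ)
open import Data.Bool using (if_then_else_)
open import Data.Fin using (Fin; _≟_)
open import Data.Fin.Permutation using (Permutation′; _⟨$⟩ʳ_; _⟨$⟩ˡ_)
open import Data.List using (List; []; _∷_; length; concatMap)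
open import Data.List.Relation.Unary.Unique.Propositional using (Unique)
open import Data.Product using (Σ; _×_; _,_)
open import Relation.Nullary.Decidable using (does)
open import Relation.Binary.PropositionalEquality using (_≡_)

commutator : ∀ {n} → Permutation′ n → Permutation′ n → Fin n → Fin n
commutator a b x = a ⟨$⟩ʳ (b ⟨$⟩ʳ (a ⟨$⟩ˡ (b ⟨$⟩ˡ x)))

Commute : ∀ {n} → Permutation′ n → Permutation′ n → Set
Commute a b = ∀ x → a ⟨$⟩ʳ (b ⟨$⟩ʳ x) ≡ b ⟨$⟩ʳ (a ⟨$⟩ʳ x)

-- The 3-cycle (a b c): a ↦ b ↦ c ↦ a, everything else fixed
-- (meaningful when a, b, c are pairwise distinct).
cycle3 : ∀ {n} → Fin n → Fin n → Fin n → Fin n → Fin n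
cycle3 a b c x =
  if does (x ≟ a) then b else
  if does (x ≟ b) then c else
  if does (x ≟ c) then a else x

Triple : ℕ → Set
Triple n = Fin n × Fin n × Fin n

prod3 : ∀ {n} → List (Triple n) → Fin n → Fin n
prod3 [] x = x
prod3 ((a , b , c) ∷ ts) x = cycle3 a b c (prod3 ts x)

entries : ∀ {n} → List (Triple n) → List (Fin n)
entries = concatMap (λ { (a , b , c) → a ∷ b ∷ c ∷ [] })

-- π is a product of k disjoint cycles of length 3: there are k triples,
-- all 3k entries pairwise distinct (so each is a genuine 3-cycle and they
-- are pairwise disjoint), whose product is π.
DisjointThreeCycles : ∀ {n} → ℕ → (Fin n → Fin n) → Set
DisjointThreeCycles {n} k π =
  Σ (List (Triple n)) λ ts →
    length ts ≡ k × Unique (entries ts) × (∀ x → π x ≡ prod3 ts x)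

-- Identify {1,…,3^l} with the vectors v ∈ (ℤ/3)^l.  Let τ_j add 1 to the
-- coordinate v_j, and let σ_i replace v_i by (v_0 + … + v_{i-1}) − v_i,
-- leaving the other coordinates alone.  Then:
--   * σ_i is an involution and τ_j has order 3;
--   * σ_i only reads coordinates ≤ i, so it commutes with τ_j for i < j;
--   * for j ≤ i, conjugating τ_j by σ_i gives σ_i τ_j σ_i = τ_i τ_j, hence
--     [σ_i, τ_j] = σ_i τ_j σ_i τ_j⁻¹ = τ_i.
-- Finally, τ_i moves every point along the 3-cycle obtained by varying the
-- i-th coordinate, so it is a product of 3^{l-1} disjoint 3-cycles.

module Submission where

open import Defs
open import Data.Nat using (ℕ; zero; suc; _^_; _∸_; _<_; _≤_; s≤s)
open import Data.Fin using (Fin; zero; suc; toℕ; _≟_; combine; remQuot)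
open import Data.Fin.Patterns using (0F; 1F; 2F)
open import Data.Fin.Permutation using (Permutation′)
open import Data.Fin.Properties using (all?; remQuot-combine; combine-remQuot)
open import Data.Product using (Σ; _×_; _,_; proj₁; proj₂)
open import Data.Product.Properties using (,-injectiveˡ; ,-injectiveʳ)
open import Data.Product.Function.NonDependent.Propositional using (_×-↔_)
open import Data.Vec using (Vec; []; _∷_; lookup; updateAt; insertAt; removeAt)
open import Data.Vec.Properties
  using (updateAt-updateAt; updateAt-id-local; insertAt-lookup; removeAt-insertAt; insertAt-removeAt)
open import Data.List using (List; []; _∷_; map; allFin; cartesianProductWith)
open import Data.List.Properties using (length-map; length-tabulate)
open import Data.List.Membership.Propositional using (_∈_)
open import Data.List.Membership.Propositional.Properties using (∈-map⁺; ∈-allFin)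
open import Data.List.Relation.Unary.Any using (here; there)
open import Data.List.Relation.Unary.All as All using (All)
open import Data.List.Relation.Unary.AllPairs using (_∷_)
open import Data.List.Relation.Unary.Unique.Propositional using (Unique)
open import Data.List.Relation.Unary.Unique.Propositional.Properties
  using (allFin⁺; cartesianProductWith⁺)
open import Function using (_∘_; _↔_; Inverse; mk↔ₛ′)
open import Function.Construct.Composition using (_↔-∘_)
open import Function.Construct.Symmetry using (↔-sym)
open import Function.Construct.Identity using (↔-id)
open import Relation.Nullary.Decidable using (from-yes; dec-true; dec-false)
open import Relation.Binary.PropositionalEquality

open Inverse using (to; from; strictlyInverseˡ; strictlyInverseʳ)

private
  variable
    l m n : ℕ

ℤ₃ : Set
ℤ₃ = Fin 3

inc : ℤ₃ → ℤ₃
inc 0F = 1F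
inc 1F = 2F
inc 2F = 0F

infixl 6 _+₃_ _-₃_

_+₃_ : ℤ₃ → ℤ₃ → ℤ₃
0F +₃ b = b
1F +₃ b = inc b
2F +₃ b = inc (inc b)

_-₃_ : ℤ₃ → ℤ₃ → ℤ₃
c -₃ 0F = c
c -₃ 1F = inc (inc c)
c -₃ 2F = inc c

inc-cube : ∀ a → inc (inc (inc a)) ≡ a
inc-cube = from-yes (all? λ a → inc (inc (inc a)) ≟ a)

+-inc : ∀ c a → c +₃ inc a ≡ inc (c +₃ a)
+-inc = from-yes (all? λ c → all? λ a → c +₃ inc a ≟ inc (c +₃ a))

inc-+ : ∀ d a → inc d +₃ a ≡ inc (d +₃ a)
inc-+ = from-yes (all? λ d → all? λ a → inc d +₃ a ≟ inc (d +₃ a))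

reflection-involutive : ∀ c a → c -₃ (c -₃ a) ≡ a
reflection-involutive = from-yes (all? λ c → all? λ a → c -₃ (c -₃ a) ≟ a)

reflection-step : ∀ d a → inc d -₃ (d -₃ a) ≡ inc a
reflection-step = from-yes (all? λ d → all? λ a → inc d -₃ (d -₃ a) ≟ inc a)

reflection-conjugates-inc : ∀ c a → c -₃ inc (c -₃ a) ≡ inc (inc a)
reflection-conjugates-inc = from-yes (all? λ c → all? λ a → c -₃ inc (c -₃ a) ≟ inc (inc a))

shift : Fin l → Vec ℤ₃ l → Vec ℤ₃ l
shift j v = updateAt v j inc

-- σ^c_i : replace v_i by c + v_0 + … + v_{i-1} − v_i (the carry c
-- accumulates the prefix sum).  The σ_i of the theorem is σ^0_i.
reflect : ℤ₃ → Fin l → Vec ℤ₃ l → Vec ℤ₃ l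
reflect c zero    (a ∷ v) = c -₃ a ∷ v
reflect c (suc i) (a ∷ v) = a ∷ reflect (c +₃ a) i v

shift-cube : ∀ (j : Fin l) v → shift j (shift j (shift j v)) ≡ v
shift-cube j v =
  trans (updateAt-updateAt j (shift j v))
    (trans (updateAt-updateAt j v) (updateAt-id-local j v (inc-cube (lookup v j))))

shift-insertAt : ∀ (i : Fin (suc l)) (w : Vec ℤ₃ l) k →
                 shift i (insertAt w i k) ≡ insertAt w i (inc k)
shift-insertAt zero    w       k = refl
shift-insertAt (suc i) (a ∷ w) k = cong (a ∷_) (shift-insertAt i w k)

reflect-involutive : ∀ c (i : Fin l) v → reflect c i (reflect c i v) ≡ v
reflect-involutive c zero    (a ∷ v) = cong (_∷ v) (reflection-involutive c a)
reflect-involutive c (suc i) (a ∷ v) = cong (a ∷_) (reflect-involutive (c +₃ a) i v)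

-- σ_i does not look at coordinate j > i, so it commutes with τ_j.
reflect-shift-commute : ∀ c (i j : Fin l) → toℕ i < toℕ j → ∀ v →
                        reflect c i (shift j v) ≡ shift j (reflect c i v)
reflect-shift-commute c zero    (suc j) _       (a ∷ v) = refl
reflect-shift-commute c (suc i) (suc j) (s≤s p) (a ∷ v) =
  cong (a ∷_) (reflect-shift-commute (c +₃ a) i j p v)

reflect-step : ∀ d (i : Fin l) v → reflect (inc d) i (reflect d i v) ≡ shift i v
reflect-step d zero    (a ∷ v) = cong (_∷ v) (reflection-step d a)
reflect-step d (suc i) (a ∷ v) = cong (a ∷_) (begin
  reflect (inc d +₃ a) i (reflect (d +₃ a) i v)   ≡⟨ cong (λ e → reflect e i (reflect (d +₃ a) i v)) (inc-+ d a) ⟩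
  reflect (inc (d +₃ a)) i (reflect (d +₃ a) i v) ≡⟨ reflect-step (d +₃ a) i v ⟩
  shift i v                                        ∎)
  where open ≡-Reasoning

-- The key identity: σ_i τ_j σ_i = τ_i τ_j for j ≤ i.  For j < i, τ_j
-- shifts the carry seen at coordinate i by one, which reflect-step turns
-- into τ_i; for j = i it is reflection-conjugates-inc.
reflect-conjugates-shift : ∀ c (i j : Fin l) → toℕ j ≤ toℕ i → ∀ v →
                           reflect c i (shift j (reflect c i v)) ≡ shift i (shift j v)
reflect-conjugates-shift c zero    zero    _       (a ∷ v) =
  cong (_∷ v) (reflection-conjugates-inc c a)
reflect-conjugates-shift c (suc i) zero    _       (a ∷ v) = cong (inc a ∷_) (begin
  reflect (c +₃ inc a) i (reflect (c +₃ a) i v)   ≡⟨ cong (λ e → reflect e i (reflect (c +₃ a) i v)) (+-inc c a) ⟩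
  reflect (inc (c +₃ a)) i (reflect (c +₃ a) i v) ≡⟨ reflect-step (c +₃ a) i v ⟩
  shift i v                                        ∎)
  where open ≡-Reasoning
reflect-conjugates-shift c (suc i) (suc j) (s≤s p) (a ∷ v) =
  cong (a ∷_) (reflect-conjugates-shift (c +₃ a) i j p v)

-- Hence [σ_i, τ_j] = σ_i τ_j σ_i τ_j⁻¹ = τ_i for j ≤ i (with τ_j⁻¹ = τ_j²).
reflect-shift-commutator : ∀ c (i j : Fin l) → toℕ j ≤ toℕ i → ∀ v →
  reflect c i (shift j (reflect c i (shift j (shift j v)))) ≡ shift i v
reflect-shift-commutator c i j j≤i v =
  trans (reflect-conjugates-shift c i j j≤i (shift j (shift j v)))
        (cong (shift i) (shift-cube j v))

shiftᵖ : Fin l → Vec ℤ₃ l ↔ Vec ℤ₃ l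
shiftᵖ j = mk↔ₛ′ (shift j) (shift j ∘ shift j) (shift-cube j) (shift-cube j)

reflectᵖ : Fin l → Vec ℤ₃ l ↔ Vec ℤ₃ l
reflectᵖ i = mk↔ₛ′ (reflect 0F i) (reflect 0F i) (reflect-involutive 0F i) (reflect-involutive 0F i)

encode : Vec (Fin m) l → Fin (m ^ l)
encode []      = zero
encode (a ∷ v) = combine a (encode v)

decode : Fin (m ^ l) → Vec (Fin m) l
decode {m} {zero}  _ = []
decode {m} {suc l} x = proj₁ (remQuot {m} (m ^ l) x) ∷ decode (proj₂ (remQuot {m} (m ^ l) x))

encode-decode : ∀ (x : Fin (m ^ l)) → encode (decode {m} {l} x) ≡ x
encode-decode {m} {zero}  zero = refl
encode-decode {m} {suc l} x =
  trans (cong (combine {m} (proj₁ q)) (encode-decode {m} {l} (proj₂ q))) (combine-remQuot {m} (m ^ l) x)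
  where q = remQuot {m} (m ^ l) x

decode-encode : ∀ (v : Vec (Fin m) l) → decode (encode v) ≡ v
decode-encode []                  = refl
decode-encode {m} {suc l} (a ∷ v) =
  trans (cong (λ (b , r) → b ∷ decode {m} {l} r) (remQuot-combine {m} {m ^ l} a (encode v)))
        (cong (a ∷_) (decode-encode v))

code : Vec (Fin m) l ↔ Fin (m ^ l)
code {m} {l} = mk↔ₛ′ encode decode (encode-decode {m} {l}) decode-encode

coordinate : ∀ {A : Set} → Fin (suc l) → (A × Vec A l) ↔ Vec A (suc l)
coordinate i = mk↔ₛ′ (λ (k , w) → insertAt w i k) (λ v → lookup v i , removeAt v i)
  (λ v → insertAt-removeAt v i)
  (λ (k , w) → cong₂ _,_ (insertAt-lookup w i k) (removeAt-insertAt w i k))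

conjugate : ∀ {A : Set} → A ↔ Fin n → A ↔ A → Permutation′ n
conjugate c f = (c ↔-∘ f) ↔-∘ ↔-sym c

module _ {A : Set} (c : A ↔ Fin n) (f g : A ↔ A) where

  conjugate-commute : (∀ v → to f (to g v) ≡ to g (to f v)) →
                      Commute (conjugate c f) (conjugate c g)
  conjugate-commute fg x rewrite strictlyInverseʳ c (to g (from c x))
                               | strictlyInverseʳ c (to f (from c x)) =
    cong (to c) (fg (from c x))

  conjugate-commutator : ∀ x → commutator (conjugate c f) (conjugate c g) x
                               ≡ to c (to f (to g (from f (from g (from c x)))))
  conjugate-commutator x rewrite strictlyInverseʳ c (from g (from c x))
                               | strictlyInverseʳ c (from f (from g (from c x)))
                               | strictlyInverseʳ c (to g (from f (from g (from c x)))) = refl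

to-injective : ∀ {A B : Set} (e : A ↔ B) {x y} → to e x ≡ to e y → x ≡ y
to-injective e {x} {y} eq =
  trans (sym (strictlyInverseʳ e x)) (trans (cong (from e) eq) (strictlyInverseʳ e y))

entry : Triple n → ℤ₃ → Fin n
entry (a , b , c) 0F = a
entry (a , b , c) 1F = b
entry (a , b , c) 2F = c

cycle3-fixes : ∀ {a b c x : Fin n} → x ≢ a → x ≢ b → x ≢ c → cycle3 a b c x ≡ x
cycle3-fixes {a = a} {b} {c} {x} x≢a x≢b x≢c
  rewrite dec-false (x ≟ a) x≢a | dec-false (x ≟ b) x≢b | dec-false (x ≟ c) x≢c = refl

cycle3-rotates : ∀ {a b c : Fin n} → a ≢ b → a ≢ c → b ≢ c →
                 ∀ k → cycle3 a b c (entry (a , b , c) k) ≡ entry (a , b , c) (inc k)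
cycle3-rotates {a = a} a≢b a≢c b≢c 0F rewrite dec-true (a ≟ a) refl = refl
cycle3-rotates {a = a} {b} a≢b a≢c b≢c 1F
  rewrite dec-false (b ≟ a) (≢-sym a≢b) | dec-true (b ≟ b) refl = refl
cycle3-rotates {a = a} {b} {c} a≢b a≢c b≢c 2F
  rewrite dec-false (c ≟ a) (≢-sym a≢c) | dec-false (c ≟ b) (≢-sym b≢c) | dec-true (c ≟ c) refl = refl

entry-∈ : ∀ {t : Triple n} {ts} → t ∈ ts → ∀ k → entry t k ∈ entries ts
entry-∈ (here refl) 0F = here refl
entry-∈ (here refl) 1F = there (here refl)
entry-∈ (here refl) 2F = there (there (here refl))
entry-∈ {ts = _ ∷ _} (there t∈ts) k = there (there (there (entry-∈ t∈ts k)))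

prod3-fixes : ∀ (ts : List (Triple n)) {x} → All (x ≢_) (entries ts) → prod3 ts x ≡ x
prod3-fixes []              _                                 = refl
prod3-fixes ((a , b , c) ∷ ts) (x≢a All.∷ x≢b All.∷ x≢c All.∷ rest) =
  trans (cong (cycle3 a b c) (prod3-fixes ts rest)) (cycle3-fixes x≢a x≢b x≢c)

prod3-rotates : ∀ (ts : List (Triple n)) → Unique (entries ts) →
                ∀ {t} → t ∈ ts → ∀ k → prod3 ts (entry t k) ≡ entry t (inc k)
prod3-rotates ((a , b , c) ∷ ts)
  ((a≢b All.∷ a≢c All.∷ a∉) ∷ (b≢c All.∷ b∉) ∷ c∉ ∷ _) (here refl) k =
  trans (cong (cycle3 a b c) (prod3-fixes ts (outside k))) (cycle3-rotates a≢b a≢c b≢c k)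
  where
    outside : ∀ k → All (entry (a , b , c) k ≢_) (entries ts)
    outside 0F = a∉
    outside 1F = b∉
    outside 2F = c∉
prod3-rotates ((a , b , c) ∷ ts)
  ((_ All.∷ _ All.∷ a∉) ∷ (_ All.∷ b∉) ∷ c∉ ∷ unique) {t} (there t∈ts) k =
  trans (cong (cycle3 a b c) (prod3-rotates ts unique t∈ts k))
        (cycle3-fixes (≢-sym (All.lookup a∉ y∈)) (≢-sym (All.lookup b∉ y∈)) (≢-sym (All.lookup c∉ y∈)))
  where
    y∈ : entry t (inc k) ∈ entries ts
    y∈ = entry-∈ t∈ts (inc k)

module _ (e : (ℤ₃ × Fin m) ↔ Fin n) where

  triple : Fin m → Triple n
  triple r = to e (0F , r) , to e (1F , r) , to e (2F , r)

  triples : List (Triple n)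
  triples = map triple (allFin m)

  entry-triple : ∀ r k → entry (triple r) k ≡ to e (k , r)
  entry-triple r 0F = refl
  entry-triple r 1F = refl
  entry-triple r 2F = refl

  entries-triples : ∀ rs →
    entries (map triple rs) ≡ cartesianProductWith (λ r k → to e (k , r)) rs (allFin 3)
  entries-triples []       = refl
  entries-triples (r ∷ rs) =
    cong (λ es → to e (0F , r) ∷ to e (1F , r) ∷ to e (2F , r) ∷ es) (entries-triples rs)

  triples-unique : Unique (entries triples)
  triples-unique = subst Unique (sym (entries-triples (allFin m)))
    (cartesianProductWith⁺ _ e-injective (allFin⁺ m) (allFin⁺ 3))
    where
      e-injective : ∀ {r r′ k k′} → to e (k , r) ≡ to e (k′ , r′) → r ≡ r′ × k ≡ k′
      e-injective eq = ,-injectiveʳ (to-injective e eq) , ,-injectiveˡ (to-injective e eq)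

  three-cycle-criterion : (π : Fin n → Fin n) →
    (∀ k r → π (to e (k , r)) ≡ to e (inc k , r)) → DisjointThreeCycles m π
  three-cycle-criterion π π-shifts =
    triples , trans (length-map triple (allFin m)) (length-tabulate (λ r → r)) , triples-unique , agrees
    where
      agrees : ∀ x → π x ≡ prod3 triples x
      agrees x = begin
        π x                           ≡⟨ cong π (strictlyInverseˡ e x) ⟨
        π (to e (k , r))              ≡⟨ π-shifts k r ⟩
        to e (inc k , r)              ≡⟨ entry-triple r (inc k) ⟨
        entry (triple r) (inc k)      ≡⟨ prod3-rotates triples triples-unique (∈-map⁺ triple (∈-allFin r)) k ⟨
        prod3 triples (entry (triple r) k) ≡⟨ cong (prod3 triples) (entry-triple r k) ⟩
        prod3 triples (to e (k , r))  ≡⟨ cong (prod3 triples) (strictlyInverseˡ e x) ⟩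
        prod3 triples x               ∎
        where
          open ≡-Reasoning
          k = proj₁ (from e x)
          r = proj₂ (from e x)

-- τ_i, transported to Fin 3^{l+1}, is a product of 3^l disjoint 3-cycles:
-- the cycles are obtained by letting the i-th coordinate run through ℤ/3.
shift-three-cycles : ∀ (i : Fin (suc l)) (π : Fin (3 ^ suc l) → Fin (3 ^ suc l)) →
  (∀ x → π x ≡ to (code {3} {suc l}) (shift i (from code x))) → DisjointThreeCycles (3 ^ l) π
shift-three-cycles {l} i π π≡τ = three-cycle-criterion e π λ k r → begin
  π (to e (k , r))                              ≡⟨ π≡τ (to e (k , r)) ⟩
  encode (shift i (decode (to e (k , r))))      ≡⟨ cong (encode ∘ shift i) (decode-encode (insertAt (decode r) i k)) ⟩
  encode (shift i (insertAt (decode r) i k))    ≡⟨ cong encode (shift-insertAt i (decode r) k) ⟩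
  to e (inc k , r)                              ∎
  where
    open ≡-Reasoning
    e : (ℤ₃ × Fin (3 ^ l)) ↔ Fin (3 ^ suc l)
    e = code ↔-∘ (coordinate i ↔-∘ (↔-id ℤ₃ ×-↔ ↔-sym (code {3} {l})))

lemma2p3 : (l : ℕ) →
    Σ (Fin l → Permutation′ (3 ^ l)) λ σ →
    Σ (Fin l → Permutation′ (3 ^ l)) λ τ →
      ((i j : Fin l) → toℕ i < toℕ j → Commute (σ i) (τ j))
      × ((i j : Fin l) → toℕ j ≤ toℕ i →
           DisjointThreeCycles (3 ^ (l ∸ 1)) (commutator (σ i) (τ j)))
lemma2p3 zero    = (λ ()) , (λ ()) , (λ ()) , (λ ())
lemma2p3 (suc l) = σ , τ , commute , three-cycles
  where
    σ τ : Fin (suc l) → Permutation′ (3 ^ suc l)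
    σ i = conjugate code (reflectᵖ i)
    τ j = conjugate code (shiftᵖ j)

    commute : (i j : Fin (suc l)) → toℕ i < toℕ j → Commute (σ i) (τ j)
    commute i j i<j = conjugate-commute code (reflectᵖ i) (shiftᵖ j) (reflect-shift-commute 0F i j i<j)

    three-cycles : (i j : Fin (suc l)) → toℕ j ≤ toℕ i →
                   DisjointThreeCycles (3 ^ l) (commutator (σ i) (τ j))
    three-cycles i j j≤i = shift-three-cycles i _ λ x →
      trans (conjugate-commutator code (reflectᵖ i) (shiftᵖ j) x)
            (cong (to code) (reflect-shift-commutator 0F i j j≤i (from code x)))
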